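{- Let $A$ be a real symmetric $n\times n$ matrix and $i\in[n]$. If $A(i)$ is nonsingular, then $A$ has the $i$-SNIP.
   Context: $A(i)$ is $A$ with row and column $i$ deleted. $A$ has the $i$-SNIP if $X=O$ is the only real symmetric matrix $X$ with $A\circ X=O$, $I\circ X=O$ ($\circ$ the entrywise product) and $(AX)(i,:]=O$, where $(AX)(i,:]$ is $AX$ with row $i$ deleted. -}

module Defs where

open import Level using (Level; _⊔_)
open import Algebra.Bundles using (CommutativeRing)
open import Data.Nat using (ℕ; zero; suc)
open import Data.Fin using (Fin; zero; suc; punchIn; _≟_)
open import Data.Product using (Σ; ∃; _×_)
open import Relation.Nullary using (¬_; yes; no)
open import Relation.Binary.PropositionalEquality using (_≡_)

IsFieldCR : ∀ {c ℓ} → CommutativeRing c ℓ → Set (c ⊔ ℓ)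
IsFieldCR R = (¬ (1# ≈ 0#)) × (∀ x → ¬ (x ≈ 0#) → ∃ λ y → x * y ≈ 1#)
  where open CommutativeRing R

module MatrixDefs {c ℓ} (R : CommutativeRing c ℓ) where
  open CommutativeRing R using (Carrier; _≈_; _+_; _*_; 0#; 1#)

  Matrix : ℕ → ℕ → Set c
  Matrix m n = Fin m → Fin n → Carrier

  Σ[_] : ∀ {n} → (Fin n → Carrier) → Carrier
  Σ[_] {zero}  f = 0#
  Σ[_] {suc n} f = f zero + Σ[ (λ j → f (suc j)) ]

  infixl 7 _⊗_ _∘ₕ_
  infix 4 _≋_

  _⊗_ : ∀ {m n p} → Matrix m n → Matrix n p → Matrix m p
  (M ⊗ N) j k = Σ[ (λ l → M j l * N l k) ]

  _∘ₕ_ : ∀ {m n} → Matrix m n → Matrix m n → Matrix m n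
  (M ∘ₕ N) j k = M j k * N j k

  I : ∀ {n} → Matrix n n
  I j k with j ≟ k
  ... | yes _ = 1#
  ... | no  _ = 0#

  O : ∀ {m n} → Matrix m n
  O _ _ = 0#

  _≋_ : ∀ {m n} → Matrix m n → Matrix m n → Set ℓ
  M ≋ N = ∀ j k → M j k ≈ N j k

  Symmetric : ∀ {n} → Matrix n n → Set ℓ
  Symmetric M = ∀ j k → M j k ≈ M k j

  Nonsingular : ∀ {n} → Matrix n n → Set (c ⊔ ℓ)
  Nonsingular {n} M = Σ (Matrix n n) λ B → (M ⊗ B ≋ I) × (B ⊗ M ≋ I)

  principalDel : ∀ {n} → Matrix (suc n) (suc n) → Fin (suc n) → Matrix n n
  principalDel A i j k = A (punchIn i j) (punchIn i k)

  deleteRow : ∀ {m n} → Matrix (suc m) n → Fin (suc m) → Matrix m n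
  deleteRow M i j k = M (punchIn i j) k

  HasSNIP : ∀ {n} → Matrix (suc n) (suc n) → Fin (suc n) → Set (c ⊔ ℓ)
  HasSNIP A i = ∀ (X : Matrix _ _) → Symmetric X →
    (A ∘ₕ X) ≋ O → (I ∘ₕ X) ≋ O → deleteRow (A ⊗ X) i ≋ O → X ≋ O

-- Since I ∘ X = O, the entry X i i vanishes. Let x be a column of X
-- with x i = 0. The rows of A X other than i read A(i) x′ = 0, where x′ is x with
-- entry i deleted (the entry that meets column i of A is zero), so x′ = 0 because
-- A(i) is invertible; hence x = 0. Applied to column i this kills column i, so by
-- symmetry row i of X vanishes, and then every column of X has a zero i-th entry.
module Submission where

open import Defs
open import Algebra.Bundles using (CommutativeRing)
open import Data.Nat using (ℕ; zero; suc)
open import Data.Fin using (Fin; zero; suc; punchIn; punchOut; _≟_)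
open import Data.Fin.Properties using (punchInᵢ≢i; punchIn-punchOut)
open import Data.Product using (_,_)
open import Function using (_∘_)
open import Relation.Nullary using (yes; no; contradiction)
open import Relation.Binary.PropositionalEquality as ≡ using (_≡_; _≢_)

punchIn-elim : ∀ {p n} {P : Fin (suc n) → Set p} (i : Fin (suc n)) →
  P i → (∀ j → P (punchIn i j)) → ∀ j → P j
punchIn-elim {P = P} i Pi P↑ j with i ≟ j
... | yes ≡.refl = Pi
... | no i≢j = ≡.subst P (punchIn-punchOut i≢j) (P↑ (punchOut i≢j))

module _ {c ℓ} (R : CommutativeRing c ℓ) where
  open CommutativeRing R hiding (zero)
  open MatrixDefs R
  open import Algebra.Properties.Semiring.Sum semiring
    using (sum; sum-cong-≋; sum-replicate-zero; sum-remove; ∑-comm; *-distribˡ-sum; *-distribʳ-sum)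
  open import Relation.Binary.Reasoning.Setoid setoid

  Σ≡sum : ∀ {n} (f : Fin n → Carrier) → Σ[ f ] ≡ sum f
  Σ≡sum {zero}  f = ≡.refl
  Σ≡sum {suc n} f = ≡.cong (f zero +_) (Σ≡sum (f ∘ suc))

  sum-zero : ∀ {n} {f : Fin n → Carrier} → (∀ j → f j ≈ 0#) → sum f ≈ 0#
  sum-zero {n} f≈0 = trans (sum-cong-≋ f≈0) (sum-replicate-zero n)

  infixr 7 _·_

  _·_ : ∀ {m n} → Matrix m n → (Fin n → Carrier) → Fin m → Carrier
  (M · x) j = sum (λ l → M j l * x l)

  column : ∀ {m n} → Matrix m n → Fin n → Fin m → Carrier
  column N k l = N l k

  ⊗-column : ∀ {m n p} (M : Matrix m n) (N : Matrix n p) j k →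
    (M ⊗ N) j k ≈ (M · column N k) j
  ⊗-column M N j k = reflexive (Σ≡sum (λ l → M j l * N l k))

  ⊗-· : ∀ {m n p} (M : Matrix m n) (N : Matrix n p) (x : Fin p → Carrier) j →
    ((M ⊗ N) · x) j ≈ (M · N · x) j
  ⊗-· M N x j = begin
    sum (λ l → (M ⊗ N) j l * x l)
      ≈⟨ sum-cong-≋ (λ l → *-congʳ (⊗-column M N j l)) ⟩
    sum (λ l → sum (λ m → M j m * N m l) * x l)
      ≈⟨ sum-cong-≋ (λ l → *-distribʳ-sum (x l) (λ m → M j m * N m l)) ⟩
    sum (λ l → sum (λ m → M j m * N m l * x l))
      ≈⟨ ∑-comm (λ l m → M j m * N m l * x l) ⟩
    sum (λ m → sum (λ l → M j m * N m l * x l))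
      ≈⟨ sum-cong-≋ (λ m → trans (sum-cong-≋ (λ l → *-assoc (M j m) (N m l) (x l)))
                                 (sym (*-distribˡ-sum (M j m) (λ l → N m l * x l)))) ⟩
    (M · N · x) j ∎

  I-diag : ∀ {n} (j : Fin n) → I j j ≈ 1#
  I-diag j with j ≟ j
  ... | yes _   = refl
  ... | no j≢j = contradiction ≡.refl j≢j

  I-offDiag : ∀ {n} {j l : Fin n} → j ≢ l → I j l ≈ 0#
  I-offDiag {j = j} {l} j≢l with j ≟ l
  ... | yes j≡l = contradiction j≡l j≢l
  ... | no _    = refl

  I-· : ∀ {n} (x : Fin n → Carrier) j → (I · x) j ≈ x j
  I-· {suc n} x j = begin
    sum (λ l → I j l * x l)
      ≈⟨ sum-remove {i = j} (λ l → I j l * x l) ⟩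
    I j j * x j + sum (λ l → I j (punchIn j l) * x (punchIn j l))
      ≈⟨ +-cong (trans (*-congʳ (I-diag j)) (*-identityˡ (x j)))
                (sum-zero (λ l → trans (*-congʳ (I-offDiag (punchInᵢ≢i j l ∘ ≡.sym))) (zeroˡ _))) ⟩
    x j + 0#
      ≈⟨ +-identityʳ (x j) ⟩
    x j ∎

  leftInvertible⇒·-injective : ∀ {n} {B C : Matrix n n} → C ⊗ B ≋ I →
    ∀ {x} → (∀ j → (B · x) j ≈ 0#) → ∀ j → x j ≈ 0#
  leftInvertible⇒·-injective {B = B} {C} CB≋I {x} Bx≈0 j = begin
    x j               ≈⟨ I-· x j ⟨
    (I · x) j         ≈⟨ sum-cong-≋ (λ l → *-congʳ (CB≋I j l)) ⟨
    ((C ⊗ B) · x) j   ≈⟨ ⊗-· C B x j ⟩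
    (C · B · x) j     ≈⟨ sum-zero (λ l → trans (*-congˡ (Bx≈0 l)) (zeroʳ (C j l))) ⟩
    0# ∎

  deleteRow-· : ∀ {n} (A : Matrix (suc n) (suc n)) (i : Fin (suc n)) {x} → x i ≈ 0# →
    ∀ j → (A · x) (punchIn i j) ≈ (principalDel A i · x ∘ punchIn i) j
  deleteRow-· A i {x} xi≈0 j = begin
    (A · x) (punchIn i j)
      ≈⟨ sum-remove {i = i} (λ l → A (punchIn i j) l * x l) ⟩
    A (punchIn i j) i * x i + (principalDel A i · x ∘ punchIn i) j
      ≈⟨ +-congʳ (trans (*-congˡ xi≈0) (zeroʳ _)) ⟩
    0# + (principalDel A i · x ∘ punchIn i) j
      ≈⟨ +-identityˡ _ ⟩
    (principalDel A i · x ∘ punchIn i) j ∎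

  column-vanishes : ∀ {n} {A X : Matrix (suc n) (suc n)} {i : Fin (suc n)} →
    Nonsingular (principalDel A i) → deleteRow (A ⊗ X) i ≋ O →
    ∀ k → X i k ≈ 0# → ∀ j → X j k ≈ 0#
  column-vanishes {A = A} {X} {i} (C , _ , CB≋I) AX≋O k Xik≈0 =
    punchIn-elim {P = λ j → X j k ≈ 0#} i Xik≈0
      (leftInvertible⇒·-injective CB≋I {column X k ∘ punchIn i} (λ j →
        trans (sym (deleteRow-· A i {column X k} Xik≈0 j))
              (trans (sym (⊗-column A X (punchIn i j) k)) (AX≋O j k))))

  I∘ₕX≋O⇒diag : ∀ {n} {X : Matrix n n} → I ∘ₕ X ≋ O → ∀ j → X j j ≈ 0#
  I∘ₕX≋O⇒diag {X = X} I∘X≋O j = begin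
    X j j         ≈⟨ *-identityˡ (X j j) ⟨
    1# * X j j    ≈⟨ *-congʳ (I-diag j) ⟨
    I j j * X j j ≈⟨ I∘X≋O j j ⟩
    0# ∎

proposition3p4 : ∀ {c ℓ} (R : CommutativeRing c ℓ) → IsFieldCR R →
    let open MatrixDefs R in
    ∀ (n : ℕ) (A : Matrix (suc n) (suc n)) (i : Fin (suc n)) →
    Symmetric A → Nonsingular (principalDel A i) → HasSNIP A i
proposition3p4 R _ n A i _ A⟨i⟩-nonsingular X X-sym _ I∘X≋O AX≋O = X≋O
  where
  open CommutativeRing R using (_≈_; 0#; trans)
  vanishes : ∀ k → X i k ≈ 0# → ∀ j → X j k ≈ 0#
  vanishes = column-vanishes R {A = A} {X} A⟨i⟩-nonsingular AX≋O

  row-i : ∀ k → X i k ≈ 0#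
  row-i k = trans (X-sym i k) (vanishes i (I∘ₕX≋O⇒diag R I∘X≋O i) k)

  X≋O : ∀ j k → X j k ≈ 0#
  X≋O j k = vanishes k (row-i k) j
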